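{- Let $\mathcal{G}=(\mathcal{V},\mathcal{E})$ and $\mathcal{G}'=(\mathcal{V}',\mathcal{E}')$ be finite graphs with no isolated vertices such that $\min\{|\mathcal{V}|,|\mathcal{V}'|\}\ge4$. Then $\mathcal{G}$ is contained in $\mathcal{G}'$ if and only if $D(\mathcal{G})\le D(\mathcal{G}')$.
   Context: An ASD is a pair $D=(\mathcal{S}_D,\mathcal{P}_D)$ with $\mathcal{S}_D$ a finite set and $\mathcal{P}_D$ a finite family of set partitions of $\mathcal{S}_D$. For partitions, $\pi\preceq\pi'$ means every block of $\pi$ lies in a block of $\pi'$; for $\phi:\mathcal{S}\to\mathcal{S}'$ and a partition $\pi$ of $\mathcal{S}'$, $\pi\circ\phi$ is the partition of $\mathcal{S}$ where $x,y$ share a block iff $\phi(x),\phi(y)$ share a block of $\pi$. $D\le D'$ means there exist $\phi:\mathcal{S}_D\to\mathcal{S}_{D'}$, $\alpha:\mathcal{P}_D\to\mathcal{P}_{D'}$ with $\alpha(\pi)\circ\phi\preceq\pi$ for all $\pi\in\mathcal{P}_D$. For an undirected graph $\mathcal{G}=(\mathcal{V},\mathcal{E})$, the graph device $D(\mathcal{G})$ has state space $\mathcal{V}$ and partition set $\{\pi_e:e\in\mathcal{E}\}$, where for $e=\{u,v\}$, $\pi_e=\{\{u\},\{v\},\mathcal{V}\setminus\{u,v\}\}$. $\mathcal{G}$ is contained in $\mathcal{G}'$ if $\mathcal{G}$ is isomorphic to a subgraph of $\mathcal{G}'$ (equivalently, there is an injective $\phi:\mathcal{V}\to\mathcal{V}'$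 mapping edges to edges). A vertex is isolated if it lies in no edge. -}

module Defs where

open import Data.Nat using (ℕ; _≤_)
open import Data.Fin using (Fin)
open import Data.Fin.Properties using ()
open import Data.List using (List; length; lookup)
open import Data.List.Relation.Unary.All using (All)
open import Data.List.Membership.Propositional using (_∈_)
open import Data.Product using (Σ; ∃; ∃-syntax; _×_; _,_; proj₁; proj₂)
open import Data.Sum using (_⊎_)
open import Relation.Binary.PropositionalEquality using (_≡_; _≢_)
open import Relation.Binary.Structures using (IsEquivalence)
open import Relation.Nullary using (¬_)
open import Function.Definitions using (Injective)
open import Level using (0ℓ; suc)

-- Set partitions of a finite set Fin S, given by their "same block"
-- relation (an equivalence relation).

record Partition (S : ℕ) : Set₁ where
  field
    Same  : Fin S → Fin S → Set
    isEqv : IsEquivalence Same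
open Partition public

_⪯_ : ∀ {S} → Partition S → Partition S → Set
π ⪯ π' = ∀ x y → Same π x y → Same π' x y

_∘ₚ_ : ∀ {S S'} → Partition S' → (Fin S → Fin S') → Partition S
Same  (π ∘ₚ φ) x y = Same π (φ x) (φ y)
isEqv (π ∘ₚ φ) = record
  { refl  = λ {x} → IsEquivalence.refl (isEqv π)
  ; sym   = IsEquivalence.sym (isEqv π)
  ; trans = IsEquivalence.trans (isEqv π) }

record ASD : Set₁ where
  field
    nStates : ℕ
    nParts  : ℕ
    part    : Fin nParts → Partition nStates
open ASD public

_≤D_ : ASD → ASD → Set
D ≤D D' =
  Σ (Fin (nStates D) → Fin (nStates D')) λ φ →
  Σ (Fin (nParts D) → Fin (nParts D')) λ α →
    ∀ p → (part D' (α p) ∘ₚ φ) ⪯ part D p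

-- Finite undirected (simple) graphs on vertex set Fin n, given by a list
-- of edges {u , v} with u ≢ v (each pair read as an unordered edge).

record Graph : Set where
  field
    nV    : ℕ
    edges : List (Fin nV × Fin nV)
    loopless : All (λ e → proj₁ e ≢ proj₂ e) edges
open Graph public

Adj : (G : Graph) → Fin (nV G) → Fin (nV G) → Set
Adj G u v = ((u , v) ∈ edges G) ⊎ ((v , u) ∈ edges G)

NoIsolated : Graph → Set
NoIsolated G = ∀ v → ∃[ u ] Adj G v u

ContainedIn : Graph → Graph → Set
ContainedIn G G' =
  Σ (Fin (nV G) → Fin (nV G')) λ φ →
    Injective _≡_ _≡_ φ × (∀ u v → Adj G u v → Adj G' (φ u) (φ v))

-- π_e for e = {u , v}: blocks {u}, {v}, V ∖ {u , v}
edgeSame : ∀ {n} → Fin n × Fin n → Fin n → Fin n → Set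
edgeSame (u , v) x y = x ≡ y ⊎ ((x ≢ u × x ≢ v) × (y ≢ u × y ≢ v))

private
  open import Data.Sum using (inj₁; inj₂)
  import Relation.Binary.PropositionalEquality as P
  edgeEqv : ∀ {n} (e : Fin n × Fin n) → IsEquivalence (edgeSame e)
  edgeEqv e = record
    { refl  = inj₁ P.refl
    ; sym   = λ { (inj₁ eq) → inj₁ (P.sym eq) ; (inj₂ (a , b)) → inj₂ (b , a) }
    ; trans = λ { (inj₁ P.refl) q → q
                ; (inj₂ p) (inj₁ P.refl) → inj₂ p
                ; (inj₂ (a , _)) (inj₂ (_ , c)) → inj₂ (a , c) } }

edgePartition : ∀ {n} → Fin n × Fin n → Partition n
Same  (edgePartition e) = edgeSame e
isEqv (edgePartition e) = edgeEqv e

graphDevice : Graph → ASD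
nStates (graphDevice G) = nV G
nParts  (graphDevice G) = length (edges G)
part    (graphDevice G) i = edgePartition (lookup (edges G) i)

module Submission where

-- (⇒) An embedding φ sends each edge e to an edge φ(e), and pulling the
--     partition π_φ(e) back along the injective φ gives back π_e.
-- (⇐) Given φ, α with π_α(e) ∘ φ ⪯ π_e, two facts are needed.
--     Injectivity: every vertex x lies on an edge e, and in π_e the
--     endpoint x is a singleton block, so φ x ≡ φ y forces x ≡ y.
--     Edges go to edges: if an endpoint x of e had φ x off the edge
--     e' = α(e), then among the (at least three) other vertices one, z,
--     also has φ z off e' (an injective map cannot put three points on
--     a two-point set); then x and z share a block of π_e, contradicting
--     that {x} is a block. So both endpoints of e land on e', i.e. e' = φ(e).

open import Defs
open import Data.Nat using (ℕ; _≤_; s≤s)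
open import Data.Fin using (Fin; zero; suc; _≟_; punchIn)
open import Data.Fin.Properties using (punchIn-injective; punchInᵢ≢i)
open import Data.List using (lookup)
open import Data.List.Relation.Unary.Any using (index)
open import Data.List.Relation.Unary.Any.Properties using (lookup-index)
open import Data.List.Membership.Propositional.Properties using (∈-lookup)
import Data.List.Relation.Unary.All as All
open import Data.Product using (_×_; _,_; proj₁; proj₂; ∃-syntax)
open import Data.Sum using (_⊎_; inj₁; inj₂; [_,_])
open import Data.Empty using (⊥-elim)
open import Function using (_∘_)
open import Function.Bundles using (_⇔_; mk⇔)
open import Function.Definitions using (Injective)
open import Relation.Nullary using (¬_; yes; no; Dec)
open import Relation.Nullary.Decidable using (_⊎-dec_)
open import Relation.Binary.PropositionalEquality using (_≡_; _≢_; refl; sym; trans; cong)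

Pair : ℕ → Set
Pair n = Fin n × Fin n

OnEdge : ∀ {n} → Pair n → Fin n → Set
OnEdge e x = x ≡ proj₁ e ⊎ x ≡ proj₂ e

onEdge? : ∀ {n} (e : Pair n) (x : Fin n) → Dec (OnEdge e x)
onEdge? e x = (x ≟ proj₁ e) ⊎-dec (x ≟ proj₂ e)

_~_ : ∀ {n} → Pair n → Pair n → Set
e ~ (u , v) = e ≡ (u , v) ⊎ e ≡ (v , u)

image : ∀ {n m} → (Fin n → Fin m) → Pair n → Pair m
image φ e = φ (proj₁ e) , φ (proj₂ e)

endpoint-singleton : ∀ {n} (e : Pair n) {x y : Fin n} →
  OnEdge e x → edgeSame e x y → x ≡ y
endpoint-singleton e x∈e (inj₁ x≡y)              = x≡y
endpoint-singleton e x∈e (inj₂ ((x≢u , x≢v) , _)) = ⊥-elim ([ x≢u , x≢v ] x∈e)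

offEdge-same : ∀ {n} (e : Pair n) {x y : Fin n} →
  ¬ OnEdge e x → ¬ OnEdge e y → edgeSame e x y
offEdge-same e x∉e y∉e = inj₂ ((x∉e ∘ inj₁ , x∉e ∘ inj₂) , (y∉e ∘ inj₁ , y∉e ∘ inj₂))

swap-⪯ : ∀ {n} (u v : Fin n) → edgePartition (v , u) ⪯ edgePartition (u , v)
swap-⪯ u v x y (inj₁ x≡y)              = inj₁ x≡y
swap-⪯ u v x y (inj₂ ((a , b) , (c , d))) = inj₂ ((b , a) , (d , c))

pullback-image : ∀ {n m} {φ : Fin n → Fin m} → Injective _≡_ _≡_ φ →
  (e : Pair n) → (edgePartition (image φ e) ∘ₚ φ) ⪯ edgePartition e
pullback-image {φ = φ} inj e x y (inj₁ φx≡φy) = inj₁ (inj φx≡φy)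
pullback-image {φ = φ} inj e x y (inj₂ ((a , b) , (c , d))) =
  inj₂ ((a ∘ cong φ , b ∘ cong φ) , (c ∘ cong φ , d ∘ cong φ))

pullback : ∀ {n m} {φ : Fin n → Fin m} → Injective _≡_ _≡_ φ →
  (e : Pair n) (e' : Pair m) → e' ~ image φ e →
  (edgePartition e' ∘ₚ φ) ⪯ edgePartition e
pullback inj e       _ (inj₁ refl) = pullback-image inj e
pullback inj (u , v) _ (inj₂ refl) x y =
  swap-⪯ u v x y ∘ pullback-image inj (v , u) x y

pair-pigeonhole : ∀ {n} (e : Pair n) {a b c : Fin n} →
  OnEdge e a → OnEdge e b → OnEdge e c → a ≡ b ⊎ a ≡ c ⊎ b ≡ c
pair-pigeonhole e (inj₁ p) (inj₁ q) _        = inj₁ (trans p (sym q))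
pair-pigeonhole e (inj₂ p) (inj₂ q) _        = inj₁ (trans p (sym q))
pair-pigeonhole e (inj₁ p) _        (inj₁ q) = inj₂ (inj₁ (trans p (sym q)))
pair-pigeonhole e (inj₂ p) _        (inj₂ q) = inj₂ (inj₁ (trans p (sym q)))
pair-pigeonhole e _        (inj₁ p) (inj₁ q) = inj₂ (inj₂ (trans p (sym q)))
pair-pigeonhole e _        (inj₂ p) (inj₂ q) = inj₂ (inj₂ (trans p (sym q)))

-- With at least four vertices, an injective map sends some vertex other
-- than x off any given edge: the three vertices punchIn x 0, 1, 2 are
-- distinct and different from x, and at most two of them land on e.
escape : ∀ {n m} {φ : Fin n → Fin m} → 4 ≤ n → Injective _≡_ _≡_ φ →
  (x : Fin n) (e : Pair m) → ∃[ z ] z ≢ x × ¬ OnEdge e (φ z)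
escape {φ = φ} (s≤s (s≤s (s≤s (s≤s _)))) inj x e
  with onEdge? e (φ (punchIn x zero))
     | onEdge? e (φ (punchIn x (suc zero)))
     | onEdge? e (φ (punchIn x (suc (suc zero))))
... | no off | _ | _         = _ , punchInᵢ≢i x _ , off
... | yes _ | no off | _     = _ , punchInᵢ≢i x _ , off
... | yes _ | yes _ | no off = _ , punchInᵢ≢i x _ , off
... | yes p | yes q | yes r =
  ⊥-elim ([ distinct _ _ (λ ()) , [ distinct _ _ (λ ()) , distinct _ _ (λ ()) ] ]
          (pair-pigeonhole e p q r))
  where
  distinct : ∀ i j → i ≢ j → φ (punchIn x i) ≢ φ (punchIn x j)
  distinct i j i≢j = i≢j ∘ punchIn-injective x i j ∘ inj

endpoint-image : ∀ {n m} {φ : Fin n → Fin m} → 4 ≤ n → Injective _≡_ _≡_ φ →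
  (e : Pair n) (e' : Pair m) → (edgePartition e' ∘ₚ φ) ⪯ edgePartition e →
  ∀ {x} → OnEdge e x → OnEdge e' (φ x)
endpoint-image {φ = φ} h4 inj e e' refines {x} x∈e with onEdge? e' (φ x)
... | yes φx∈e' = φx∈e'
... | no φx∉e' with escape h4 inj x e'
...   | z , z≢x , φz∉e' =
  ⊥-elim (z≢x (sym (endpoint-singleton e x∈e (refines x z (offEdge-same e' φx∉e' φz∉e')))))

edge-recognition : ∀ {n m} {φ : Fin n → Fin m} → 4 ≤ n → Injective _≡_ _≡_ φ →
  (e : Pair n) (e' : Pair m) → proj₁ e ≢ proj₂ e →
  (edgePartition e' ∘ₚ φ) ⪯ edgePartition e → e' ~ image φ e
edge-recognition h4 inj e e' u≢v refines
  with endpoint-image h4 inj e e' refines (inj₁ refl)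
     | endpoint-image h4 inj e e' refines (inj₂ refl)
... | inj₁ p    | inj₁ q    = ⊥-elim (u≢v (inj (trans p (sym q))))
... | inj₂ p    | inj₂ q    = ⊥-elim (u≢v (inj (trans p (sym q))))
... | inj₁ refl | inj₂ refl = inj₁ refl
... | inj₂ refl | inj₁ refl = inj₂ refl

Edge : (G : Graph) → Fin _ → Pair (nV G)
Edge G i = lookup (edges G) i

adj⇒index : ∀ G {u v} → Adj G u v → ∃[ i ] Edge G i ~ (u , v)
adj⇒index G (inj₁ p) = index p , inj₁ (sym (lookup-index p))
adj⇒index G (inj₂ p) = index p , inj₂ (sym (lookup-index p))

index⇒adj : ∀ G {u v} i → Edge G i ~ (u , v) → Adj G u v
index⇒adj G i (inj₁ refl) = inj₁ (∈-lookup i)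
index⇒adj G i (inj₂ refl) = inj₂ (∈-lookup i)

~-onEdge : ∀ {n} {e : Pair n} {u v} → e ~ (u , v) → OnEdge e u
~-onEdge (inj₁ refl) = inj₁ refl
~-onEdge (inj₂ refl) = inj₂ refl

~-image : ∀ {n m} {φ : Fin n → Fin m} {e : Pair n} {e' : Pair m} {u v} →
  e' ~ image φ e → e ~ (u , v) → e' ~ (φ u , φ v)
~-image (inj₁ refl) (inj₁ refl) = inj₁ refl
~-image (inj₁ refl) (inj₂ refl) = inj₂ refl
~-image (inj₂ refl) (inj₁ refl) = inj₂ refl
~-image (inj₂ refl) (inj₂ refl) = inj₁ refl

EdgesToEdges : (G G' : Graph) → (Fin (nV G) → Fin (nV G')) → Set
EdgesToEdges G G' φ = ∀ i → ∃[ j ] Edge G' j ~ image φ (Edge G i)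

adj-preserving⇒edgesToEdges : ∀ G G' {φ} →
  (∀ u v → Adj G u v → Adj G' (φ u) (φ v)) → EdgesToEdges G G' φ
adj-preserving⇒edgesToEdges G G' preserves i =
  adj⇒index G' (preserves _ _ (inj₁ (∈-lookup i)))

edgesToEdges⇒adj-preserving : ∀ G G' {φ} →
  EdgesToEdges G G' φ → ∀ u v → Adj G u v → Adj G' (φ u) (φ v)
edgesToEdges⇒adj-preserving G G' images u v uv
  with adj⇒index G uv
... | i , i~uv with images i
...   | j , j~φi = index⇒adj G' j (~-image j~φi i~uv)

-- An embedding yields φ together with α(i) = index of the image edge.
embedding⇒≤D : ∀ G G' → ContainedIn G G' → graphDevice G ≤D graphDevice G'
embedding⇒≤D G G' (φ , inj , preserves) =
  φ , proj₁ ∘ images , λ i → pullback inj (Edge G i) _ (proj₂ (images i))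
  where
  images : EdgesToEdges G G' φ
  images = adj-preserving⇒edgesToEdges G G' preserves

-- The vertex map of D(G) ≤ D(G') is injective when G has no isolated
-- vertex: x lies on an edge e, and {x} is a block of π_e.
≤D-injective : ∀ G G' → NoIsolated G → ((φ , _ , _) : graphDevice G ≤D graphDevice G') →
  Injective _≡_ _≡_ φ
≤D-injective G G' noIsolated (φ , α , refines) {x} {y} φx≡φy
  with noIsolated x
... | u , xu with adj⇒index G xu
...   | i , i~xu = endpoint-singleton (Edge G i) (~-onEdge i~xu) (refines i x y (inj₁ φx≡φy))

≤D⇒embedding : ∀ G G' → NoIsolated G → 4 ≤ nV G →
  graphDevice G ≤D graphDevice G' → ContainedIn G G'
≤D⇒embedding G G' noIsolated h4 (φ , α , refines) =
  φ , inj , edgesToEdges⇒adj-preserving G G' images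
  where
  inj : Injective _≡_ _≡_ φ
  inj = ≤D-injective G G' noIsolated (φ , α , refines)

  images : EdgesToEdges G G' φ
  images i = α i , edge-recognition h4 inj (Edge G i) (Edge G' (α i))
                     (All.lookup (loopless G) (∈-lookup i)) (refines i)

lemma3 : (G G' : Graph) → NoIsolated G → NoIsolated G' →
         4 ≤ nV G → 4 ≤ nV G' →
         ContainedIn G G' ⇔ (graphDevice G ≤D graphDevice G')
lemma3 G G' noIsolated _ h4 _ =
  mk⇔ (embedding⇒≤D G G') (≤D⇒embedding G G' noIsolated h4)
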